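{- There exists a GLS$(1,3;2,(3,\{3\},\{3\},\{3\}),5)$.
   Context: An S$(\lambda;2,K,v)$ is a pair $(X,\mathcal{B})$, $|X|=v$, $\mathcal{B}$ a multiset of subsets (blocks) of $X$ with sizes in $K$, each 2-subset of $X$ in exactly $\lambda$ blocks. An S$(3,K,v)$ is a pair $(X,\mathcal{B})$ with $\mathcal{B}$ a set of subsets of sizes in $K$, each 3-subset in exactly one block. An LS$(1,\lambda;2,(3,K),v)$ is a collection $(X,\mathcal{B}_r)_{r\in R}$ of S$(\lambda;2,K,v)$ on a common $X$ such that $(X,\bigcup_r\mathcal{B}_r)$ (ordinary union) is an S$(3,K,v)$ and each block $B$ of that union occurs exactly $|B|-2$ times in the multiset $\{B: B\in\mathcal{B}_r, r\in R\}$. An S$(\lambda;2,(K_0,K_1,K_2),v)$ is a quadruple $(S,\infty_1,\infty_2,\mathcal{B})$ with $|S|=v-2$, $\infty_1\ne\infty_2$, $\infty_1,\infty_2\notin S$, such that $(S\cup\{\infty_1,\infty_2\},\mathcal{B})$ is an S$(\lambda;2,K_0\cup K_1\cup K_2,v)$ and $|B|\in K_i$ for each block $B$ with $|B\cap\{\infty_1,\infty_2\}|=i$. An LS$(1,\lambda;2,(3,K_0,K_1,K_2),v)$ is a collection $(S,\infty_1,\infty_2,\mathcal{B}_r)_{r\in R}$ of such designs with $(S\cup\{\infty_1,\infty_2\},\mathcal{B}_r)_{r\in R}$ an LS$(1,\lambda;2,(3,K_0\cup K_1\cup K_2),v)$. A good design GS$(\lambda;2,(K_0,\{3\},K_2),v)$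 is a 5-tuple $(S,\infty_1,\infty_2,\mathcal{B},D)$ where $(S,\infty_1,\infty_2,\mathcal{B})$ is an S$(\lambda;2,(K_0,\{3\},K_2),v)$ and $D$ is an Eulerian digraph on $S$ (every vertex has equal in-degree and out-degree) whose underlying undirected graph has edge set $\{\{x,y\}: x,y\in S, \{\infty_i,x,y\}\in\mathcal{B}, i\in\{1,2\}\}$. A GLS$(1,\lambda;2,(3,K_0,\{3\},K_2),v)$ is a collection $(S,\infty_1,\infty_2,\mathcal{B}_r,D_r)_{r\in R}$ of such GS where $(S,\infty_1,\infty_2,\mathcal{B}_r)_{r\in R}$ is an LS$(1,\lambda;2,(3,K_0,\{3\},K_2),v)$ and every ordered pair $(x,y)$ of distinct elements of $S$ not contained in any block $B$ with $\{\infty_1,\infty_2\}\subset B$ is an arc of exactly one $D_r$. -}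

module Defs where

open import Data.Nat using (ℕ; zero; suc; _+_; _∸_)
open import Data.Bool using (Bool; true; false; T?)
open import Data.Fin using (Fin)
open import Data.Fin.Subset using (Subset; _∈_; _∉_; ⁅_⁆; _∪_; ∣_∣)
open import Data.Fin.Subset.Properties using (_∈?_)
open import Data.List using (List; length; filter; map; concatMap; allFin)
open import Data.List.Relation.Unary.All using (All)
open import Data.List.Membership.Propositional using () renaming (_∈_ to _∈ᴸ_)
open import Data.Product using (Σ; ∃; ∃-syntax; _×_; _,_)
open import Data.Sum using (_⊎_)
open import Relation.Binary.PropositionalEquality using (_≡_; _≢_)
open import Relation.Nullary.Decidable using (_×-dec_; does)
import Data.Vec.Properties as VecP
import Data.Bool.Properties as BoolP

-- Point set X = Fin v.  Blocks are subsets of Fin v (Data.Fin.Subset);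
-- a multiset of blocks is a List of blocks (multiplicity = number of occurrences).

_≟B_ : ∀ {v} (A B : Subset v) → Relation.Nullary.Decidable.Dec (A ≡ B)
_≟B_ = VecP.≡-dec BoolP._≟_
  where import Relation.Nullary.Decidable

mult : ∀ {v} → Subset v → List (Subset v) → ℕ
mult B Bs = length (filter (λ A → A ≟B B) Bs)

pairCount : ∀ {v} → List (Subset v) → Fin v → Fin v → ℕ
pairCount Bs x y = length (filter (λ B → (x ∈? B) ×-dec (y ∈? B)) Bs)

IsS2 : ∀ {v} → ℕ → (ℕ → Set) → List (Subset v) → Set
IsS2 {v} λ' K Bs =
  All (λ B → K ∣ B ∣) Bs ×
  (∀ (x y : Fin v) → x ≢ y → pairCount Bs x y ≡ λ')

-- S(3,K,v): a SET of blocks (given here as the set of blocks of a list), sizes in K,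
-- every 3-subset contained in exactly one block.
-- (Blocks are identified by equality of subsets, so listing a block twice is harmless.)
IsS3 : ∀ {v} → (ℕ → Set) → List (Subset v) → Set
IsS3 {v} K Bs =
  All (λ B → K ∣ B ∣) Bs ×
  (∀ (x y z : Fin v) → x ≢ y → x ≢ z → y ≢ z →
     Σ (Subset v) λ B → B ∈ᴸ Bs × x ∈ B × y ∈ B × z ∈ B ×
       (∀ B′ → B′ ∈ᴸ Bs → x ∈ B′ → y ∈ B′ → z ∈ B′ → B′ ≡ B))

allBlocks : ∀ {v m} → (Fin m → List (Subset v)) → List (Subset v)
allBlocks {m = m} Bs = concatMap Bs (allFin m)

-- LS(1,λ;2,(3,K),v), family indexed by R = Fin m.
-- The ordinary union ⋃ B_r has as elements exactly the blocks of allBlocks Bs.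
IsLS : ∀ {v m} → ℕ → (ℕ → Set) → (Fin m → List (Subset v)) → Set
IsLS {v} λ' K Bs =
  (∀ r → IsS2 λ' K (Bs r)) ×
  IsS3 K (allBlocks Bs) ×
  (∀ B → B ∈ᴸ allBlocks Bs → mult B (allBlocks Bs) ≡ ∣ B ∣ ∸ 2)

infCount : ∀ {v} → Fin v → Fin v → Subset v → ℕ
infCount i₁ i₂ B = (if does (i₁ ∈? B) then 1 else 0) + (if does (i₂ ∈? B) then 1 else 0)
  where open import Data.Bool using (if_then_else_)

selK : (ℕ → Set) → (ℕ → Set) → (ℕ → Set) → ℕ → (ℕ → Set)
selK K₀ K₁ K₂ zero = K₀
selK K₀ K₁ K₂ (suc zero) = K₁
selK K₀ K₁ K₂ (suc (suc _)) = K₂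

_∪K_∪K_ : (ℕ → Set) → (ℕ → Set) → (ℕ → Set) → (ℕ → Set)
(K₀ ∪K K₁ ∪K K₂) k = K₀ k ⊎ K₁ k ⊎ K₂ k

K3 : ℕ → Set
K3 k = k ≡ 3

InS : ∀ {v} → Fin v → Fin v → Fin v → Set
InS i₁ i₂ x = x ≢ i₁ × x ≢ i₂

IsSinf : ∀ {v} → ℕ → (ℕ → Set) → (ℕ → Set) → (ℕ → Set) →
         Fin v → Fin v → List (Subset v) → Set
IsSinf λ' K₀ K₁ K₂ i₁ i₂ Bs =
  i₁ ≢ i₂ ×
  IsS2 λ' (K₀ ∪K K₁ ∪K K₂) Bs ×
  All (λ B → selK K₀ K₁ K₂ (infCount i₁ i₂ B) ∣ B ∣) Bs

countTrue : List Bool → ℕ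
countTrue bs = length (filter T? bs)

outdeg : ∀ {v} → (Fin v → Fin v → Bool) → Fin v → ℕ
outdeg {v} D x = countTrue (map (D x) (allFin v))

indeg : ∀ {v} → (Fin v → Fin v → Bool) → Fin v → ℕ
indeg {v} D x = countTrue (map (λ y → D y x) (allFin v))

IsGoodDigraph : ∀ {v} → Fin v → Fin v → List (Subset v) → (Fin v → Fin v → Bool) → Set
IsGoodDigraph {v} i₁ i₂ Bs D =
  (∀ x y → D x y ≡ true → InS i₁ i₂ x × InS i₁ i₂ y × x ≢ y) ×
  (∀ x → indeg D x ≡ outdeg D x) ×
  (∀ x y → InS i₁ i₂ x → InS i₁ i₂ y →
     ((D x y ≡ true ⊎ D y x ≡ true) →
        ((⁅ i₁ ⁆ ∪ ⁅ x ⁆ ∪ ⁅ y ⁆) ∈ᴸ Bs ⊎ (⁅ i₂ ⁆ ∪ ⁅ x ⁆ ∪ ⁅ y ⁆) ∈ᴸ Bs)) ×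
     (((⁅ i₁ ⁆ ∪ ⁅ x ⁆ ∪ ⁅ y ⁆) ∈ᴸ Bs ⊎ (⁅ i₂ ⁆ ∪ ⁅ x ⁆ ∪ ⁅ y ⁆) ∈ᴸ Bs) →
        (D x y ≡ true ⊎ D y x ≡ true)))

IsGS : ∀ {v} → ℕ → (ℕ → Set) → (ℕ → Set) →
       Fin v → Fin v → List (Subset v) → (Fin v → Fin v → Bool) → Set
IsGS λ' K₀ K₂ i₁ i₂ Bs D = IsSinf λ' K₀ K3 K₂ i₁ i₂ Bs × IsGoodDigraph i₁ i₂ Bs D

arcCount : ∀ {v m} → (Fin m → Fin v → Fin v → Bool) → Fin v → Fin v → ℕ
arcCount {m = m} Ds x y = countTrue (map (λ r → Ds r x y) (allFin m))

IsGLS : ∀ {v m} → ℕ → (ℕ → Set) → (ℕ → Set) → Fin v → Fin v →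
        (Fin m → List (Subset v)) → (Fin m → Fin v → Fin v → Bool) → Set
IsGLS {v} λ' K₀ K₂ i₁ i₂ Bs Ds =
  (∀ r → IsGS λ' K₀ K₂ i₁ i₂ (Bs r) (Ds r)) ×
  IsLS λ' (K₀ ∪K K3 ∪K K₂) Bs ×
  (∀ x y → InS i₁ i₂ x → InS i₁ i₂ y → x ≢ y →
     (∀ B → B ∈ᴸ allBlocks Bs → i₁ ∈ B → i₂ ∈ B → x ∈ B → y ∈ B → Data.Empty.⊥) →
     arcCount Ds x y ≡ 1)
  where import Data.Empty

module Submission where

open import Defs
open import Data.Nat using (ℕ; zero; suc; _∸_)
open import Data.Nat.Properties using () renaming (_≟_ to _≟ℕ_)
open import Data.Fin using (Fin; #_)
open import Data.Fin.Properties using (all?) renaming (_≟_ to _≟F_)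
open import Data.Fin.Subset using (Subset; ⁅_⁆; _∪_; ∣_∣; _∈_)
open import Data.Fin.Subset.Properties using (_∈?_)
open import Data.List using (List; []; _∷_)
open import Data.List.Relation.Unary.All as All using (All)
open import Data.List.Membership.Propositional using () renaming (_∈_ to _∈ᴸ_)
open import Data.List.Membership.DecPropositional (_≟B_ {5}) using () renaming (_∈?_ to _∈ᴸ?_)
open import Data.Bool using (Bool; true)
open import Data.Bool.Properties using () renaming (_≟_ to _≟𝔹_)
open import Data.Product using (Σ; _×_; _,_)
open import Data.Sum using (_⊎_; inj₁)
open import Relation.Binary.PropositionalEquality using (_≡_; _≢_)
open import Relation.Nullary using (Dec; yes)
open import Relation.Nullary.Decidable using (toWitness; _×-dec_; _⊎-dec_; _→-dec_; ¬?; does)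

-- The ten triples of a 5-set form a 2-design with λ = 3 (each pair lies in the
-- triples through one of the other three points), and trivially an S(3,3,5) in
-- which every block occurs once = |B| − 2 times; so a single such design is a
-- large set.  With ∞₁ = 0 and ∞₂ = 1, the triples meeting {∞₁,∞₂} once cover all
-- pairs of S = {2,3,4}, and the complete symmetric digraph on S is Eulerian and
-- contains every ordered pair of S exactly once.

does≡true⇒witness : ∀ {a} {A : Set a} (a? : Dec A) → does a? ≡ true → A
does≡true⇒witness (yes a) _ = a

IsS2-mono : ∀ {v λ′} {K K′ : ℕ → Set} {Bs : List (Subset v)} →
            (∀ {k} → K k → K′ k) → IsS2 λ′ K Bs → IsS2 λ′ K′ Bs
IsS2-mono K⊆K′ (sizes , pairs) = All.map K⊆K′ sizes , pairs

selK-const : ∀ {K : ℕ → Set} n {k} → K k → selK K K K n k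
selK-const zero          k∈K = k∈K
selK-const (suc zero)    k∈K = k∈K
selK-const (suc (suc _)) k∈K = k∈K

K3⊆K3∪K3∪K3 : ∀ {k : ℕ} → K3 k → (K3 ∪K K3 ∪K K3) k
K3⊆K3∪K3∪K3 = inj₁

triple : ∀ {v} → Fin v → Fin v → Fin v → Subset v
triple x y z = ⁅ x ⁆ ∪ ⁅ y ⁆ ∪ ⁅ z ⁆

allTriples : List (Subset 5)
allTriples =
  triple (# 0) (# 1) (# 2) ∷ triple (# 0) (# 1) (# 3) ∷ triple (# 0) (# 1) (# 4) ∷
  triple (# 0) (# 2) (# 3) ∷ triple (# 0) (# 2) (# 4) ∷ triple (# 0) (# 3) (# 4) ∷
  triple (# 1) (# 2) (# 3) ∷ triple (# 1) (# 2) (# 4) ∷ triple (# 1) (# 3) (# 4) ∷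
  triple (# 2) (# 3) (# 4) ∷ []

∞₁ ∞₂ : Fin 5
∞₁ = # 0
∞₂ = # 1

inS? : (x : Fin 5) → Dec (InS ∞₁ ∞₂ x)
inS? x = ¬? (x ≟F ∞₁) ×-dec ¬? (x ≟F ∞₂)

completeDigraphOnS : Fin 5 → Fin 5 → Bool
completeDigraphOnS x y = does (inS? x ×-dec inS? y ×-dec ¬? (x ≟F y))

allTriples-sizes : All (λ B → K3 ∣ B ∣) allTriples
allTriples-sizes = toWitness {a? = All.all? (λ B → ∣ B ∣ ≟ℕ 3) allTriples} _

allTriples-pairCount : ∀ x y → x ≢ y → pairCount allTriples x y ≡ 3
allTriples-pairCount = toWitness
  {a? = all? λ x → all? λ y → ¬? (x ≟F y) →-dec (pairCount allTriples x y ≟ℕ 3)} _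

allTriples-S2 : IsS2 3 K3 allTriples
allTriples-S2 = allTriples-sizes , allTriples-pairCount

allTriples-S2-∪ : IsS2 3 (K3 ∪K K3 ∪K K3) allTriples
allTriples-S2-∪ = IsS2-mono {K = K3} K3⊆K3∪K3∪K3 allTriples-S2

UniqueBlockThrough : Fin 5 → Fin 5 → Fin 5 → Set
UniqueBlockThrough x y z =
  triple x y z ∈ᴸ allTriples × x ∈ triple x y z × y ∈ triple x y z × z ∈ triple x y z ×
  All (λ B → x ∈ B → y ∈ B → z ∈ B → B ≡ triple x y z) allTriples

allTriples-unique : ∀ x y z → x ≢ y → x ≢ z → y ≢ z → UniqueBlockThrough x y z
allTriples-unique = toWitness {a? = all? λ x → all? λ y → all? λ z →
  ¬? (x ≟F y) →-dec ¬? (x ≟F z) →-dec ¬? (y ≟F z) →-dec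
  (triple x y z ∈ᴸ? allTriples ×-dec x ∈? triple x y z ×-dec
   y ∈? triple x y z ×-dec z ∈? triple x y z ×-dec
   All.all? (λ B → x ∈? B →-dec y ∈? B →-dec z ∈? B →-dec (B ≟B triple x y z)) allTriples)} _

allTriples-S3 : IsS3 (K3 ∪K K3 ∪K K3) allTriples
allTriples-S3 = All.map K3⊆K3∪K3∪K3 allTriples-sizes , λ x y z x≢y x≢z y≢z →
  let (xyz∈ , x∈ , y∈ , z∈ , unique) = allTriples-unique x y z x≢y x≢z y≢z
  in triple x y z , xyz∈ , x∈ , y∈ , z∈ , λ B B∈ → All.lookup unique B∈

allTriples-mult : All (λ B → mult B allTriples ≡ ∣ B ∣ ∸ 2) allTriples
allTriples-mult = toWitness
  {a? = All.all? (λ B → mult B allTriples ≟ℕ (∣ B ∣ ∸ 2)) allTriples} _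

completeDigraphOnS-arcs : ∀ x y → completeDigraphOnS x y ≡ true →
                          InS ∞₁ ∞₂ x × InS ∞₁ ∞₂ y × x ≢ y
completeDigraphOnS-arcs x y = does≡true⇒witness (inS? x ×-dec inS? y ×-dec ¬? (x ≟F y))

completeDigraphOnS-Eulerian : ∀ x → indeg completeDigraphOnS x ≡ outdeg completeDigraphOnS x
completeDigraphOnS-Eulerian = toWitness
  {a? = all? λ x → indeg completeDigraphOnS x ≟ℕ outdeg completeDigraphOnS x} _

Edge : Fin 5 → Fin 5 → Set
Edge x y = completeDigraphOnS x y ≡ true ⊎ completeDigraphOnS y x ≡ true

edge? : ∀ x y → Dec (Edge x y)
edge? x y = (completeDigraphOnS x y ≟𝔹 true) ⊎-dec (completeDigraphOnS y x ≟𝔹 true)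

InfinityTriple : Fin 5 → Fin 5 → Set
InfinityTriple x y = triple ∞₁ x y ∈ᴸ allTriples ⊎ triple ∞₂ x y ∈ᴸ allTriples

infinityTriple? : ∀ x y → Dec (InfinityTriple x y)
infinityTriple? x y = (triple ∞₁ x y ∈ᴸ? allTriples) ⊎-dec (triple ∞₂ x y ∈ᴸ? allTriples)

completeDigraphOnS-underlying : ∀ x y → InS ∞₁ ∞₂ x → InS ∞₁ ∞₂ y →
  (Edge x y → InfinityTriple x y) × (InfinityTriple x y → Edge x y)
completeDigraphOnS-underlying = toWitness {a? = all? λ x → all? λ y →
  inS? x →-dec inS? y →-dec
  ((edge? x y →-dec infinityTriple? x y) ×-dec (infinityTriple? x y →-dec edge? x y))} _

completeDigraphOnS-good : IsGoodDigraph ∞₁ ∞₂ allTriples completeDigraphOnS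
completeDigraphOnS-good =
  completeDigraphOnS-arcs , completeDigraphOnS-Eulerian , completeDigraphOnS-underlying

completeDigraphOnS-arcCount : ∀ x y → InS ∞₁ ∞₂ x → InS ∞₁ ∞₂ y → x ≢ y →
                              arcCount {m = 1} (λ _ → completeDigraphOnS) x y ≡ 1
completeDigraphOnS-arcCount = toWitness {a? = all? λ x → all? λ y →
  inS? x →-dec inS? y →-dec ¬? (x ≟F y) →-dec
  (arcCount {m = 1} (λ _ → completeDigraphOnS) x y ≟ℕ 1)} _

allTriples-GS : IsGS 3 K3 K3 ∞₁ ∞₂ allTriples completeDigraphOnS
allTriples-GS =
  ((λ ()) , allTriples-S2-∪ ,
   All.map (λ {B} → selK-const (infCount ∞₁ ∞₂ B) {∣ B ∣}) allTriples-sizes) ,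
  completeDigraphOnS-good

lemma2p4 : Σ ℕ λ m → Σ (Fin 5) λ i₁ → Σ (Fin 5) λ i₂ →
    Σ (Fin m → List (Subset 5)) λ Bs → Σ (Fin m → Fin 5 → Fin 5 → Bool) λ Ds →
      IsGLS 3 K3 K3 i₁ i₂ Bs Ds
lemma2p4 = 1 , ∞₁ , ∞₂ , (λ _ → allTriples) , (λ _ → completeDigraphOnS) ,
  (λ _ → allTriples-GS) ,
  ((λ _ → allTriples-S2-∪) ,
   allTriples-S3 ,
   λ B B∈ → All.lookup allTriples-mult B∈) ,
  λ x y x∈S y∈S x≢y _ → completeDigraphOnS-arcCount x y x∈S y∈S x≢y
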